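{- For every integer $n>1$, $$E_n=\sum_{N=1}^{\lfloor n/2\rfloor}(-1)^N\sum_{1\le q_1,\ldots,q_{2N-1}\le\lfloor n/2\rfloor}\binom{n-1}{2q_1-1,\ldots,2q_{2N-1}-1}.$$
   Context: The Euler numbers $E_n$ are defined by $\frac{1}{\cosh z}=\sum_{n\ge0}\frac{E_n}{n!}z^n$ (so $E_n=0$ for odd $n$). Notation: $\binom{n}{r_1,\ldots,r_K}:=\frac{n!}{r_1!\cdots r_K!}\delta_{n,r_1+\cdots+r_K}$, so the inner sum runs over compositions of $n-1$ into $2N-1$ odd positive parts. -}

module Defs where

open import Data.Nat as ℕ using (ℕ; zero; suc; NonZero; _≟_; _≡ᵇ_; _/_)
open import Data.Nat.Properties using (_!≢0; m*n≢0)
open import Data.Nat.Combinatorics using (_C_)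
open import Data.Nat.Base using (_!; _∸_)
open import Data.Integer as ℤ using (ℤ; +_; -_)
open import Data.Bool using (if_then_else_)
open import Data.List using (List; []; _∷_; map; foldr; applyUpTo; concatMap)
open import Data.Nat.ListAction using (sum)
open import Relation.Nullary using (yes; no)

Σℤ : List ℤ → ℤ
Σℤ = foldr ℤ._+_ (+ 0)

-- Euler numbers.
-- 1/cosh z = Σ E_n z^n/n!  means (cosh z)·(Σ E_n z^n/n!) = 1 as formal
-- exponential power series, i.e. for every n
--   Σ_{k=0}^{n} [n-k even] C(n,k) E_k = δ_{n,0}.
-- Eaux f n computes E_n correctly whenever the fuel f exceeds n.

Eaux : ℕ → ℕ → ℤ
Eaux zero    n       = + 0
Eaux (suc f) zero    = + 1
Eaux (suc f) (suc m) =
  - Σℤ (applyUpTo (λ k → if ((suc m ∸ k) ℕ.% 2) ≡ᵇ 0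
                            then (+ (suc m C k)) ℤ.* Eaux f k
                            else + 0) (suc m))

E : ℕ → ℤ
E n = Eaux (suc n) n

prodFact : List ℕ → ℕ
prodFact []       = 1
prodFact (r ∷ rs) = r ! ℕ.* prodFact rs

prodFact≢0 : ∀ rs → NonZero (prodFact rs)
prodFact≢0 []       = _
prodFact≢0 (r ∷ rs) = m*n≢0 (r !) (prodFact rs) {{r !≢0}} {{prodFact≢0 rs}}

multinomial : ℕ → List ℕ → ℕ
multinomial n rs with sum rs ≟ n
... | yes _ = (n !) / prodFact rs
  where instance _ = prodFact≢0 rs
... | no  _ = 0

tuples : ℕ → List ℕ → List (List ℕ)
tuples zero    xs = [] ∷ []
tuples (suc k) xs = concatMap (λ x → map (x ∷_) (tuples k xs)) xs

oneTo : ℕ → List ℕ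
oneTo m = applyUpTo suc m

eulerRHS : ℕ → ℤ
eulerRHS n =
  Σℤ (map (λ N → (ℤ.-1ℤ ℤ.^ N) ℤ.*
                 (+ sum (map (λ qs → multinomial (n ∸ 1) (map (λ q → 2 ℕ.* q ∸ 1) qs))
                             (tuples (2 ℕ.* N ∸ 1) (oneTo (n / 2))))))
          (oneTo (n / 2)))

-- Work with exponential generating functions.  For e = 1/cosh, differentiating
-- e·cosh = 1 gives e′ = −e²·sinh, and e²·(1 + sinh²) = e²·cosh² = 1 rewrites
-- e²·p as p − e²·sinh²·p.  Telescoping,
--   e′ = Σ_{N<L} (−1)^(N+1) sinh^(2N+1) + (−1)^L e²·sinh^(2L+1),
-- whose remainder has no coefficients below degree 2L+1.  The coefficient of
-- z^m/m! in sinh^K is the sum of binom(m; r_1,…,r_K) over odd parts r_i, and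
-- E_{m+1} is the coefficient of z^m/m! in e′.
module Submission where

open import Defs
open import Data.Nat using (ℕ; _<_)
open import Relation.Binary.PropositionalEquality using (_≡_)

open import Data.Nat as ℕ using (zero; suc; pred; z≤n; s≤s; z<s; _≤_; _∸_; _≡ᵇ_; _≟_; _!; _/_; NonZero)
open import Data.Nat.Divisibility using (_∣_; ∣-refl; ∣-trans; *-monoʳ-∣)
open import Data.Nat.DivMod using (m*n/n≡m; m/n*n≡m; m≡m%n+[m/n]*n; m%n<n)
open import Data.Nat.ListAction using (sum)
open import Data.Nat.ListAction.Properties using (sum-++)
import Data.Nat.Tactic.RingSolver as ℕ-Solver
open import Data.Nat.Combinatorics
  using (_C_; nCn≡1; nCk+nC[k+1]≡[n+1]C[k+1]; k>n⇒nCk≡0; nCk≡n!/k![n-k]!; k![n∸k]!∣n!)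
import Data.Nat.Properties as ℕₚ
open import Data.Integer using (ℤ; +_; -_; _+_; _*_; -1ℤ; _^_)
open import Data.Integer.Properties
  using (+-assoc; +-comm; +-identityˡ; +-identityʳ; *-assoc; *-comm; *-identityˡ;
         *-identityʳ; *-zeroˡ; *-zeroʳ; *-distribʳ-+; neg-distrib-+; neg-distribʳ-*;
         pos-+; pos-*; +-inverseʳ; +-0-abelianGroup)
open import Algebra.Properties.AbelianGroup +-0-abelianGroup using (inverseˡ-unique)
open import Data.Integer.Tactic.RingSolver using (solve-∀)
open import Data.Bool using (if_then_else_)
open import Data.List as List using (List; []; _∷_; map; applyUpTo; concatMap)
open import Data.List.Properties using (map-++; map-cong; map-∘; map-applyUpTo)
open import Data.Empty using (⊥-elim)
open import Function using (_∘_)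
open import Relation.Nullary using (Dec; yes; no)
open import Relation.Binary.PropositionalEquality
  using (_≗_; _≢_; refl; sym; trans; cong; cong₂; subst; module ≡-Reasoning)

-- Coefficient sequences of exponential generating functions.  ∂ is
-- differentiation, and the product is defined by the Leibniz rule
-- ∂ (a ⋆ b) = ∂ a ⋆ b + a ⋆ ∂ b; by ⋆-binomial it is the binomial convolution.
Seq : Set
Seq = ℕ → ℤ

∂ : Seq → Seq
∂ a k = a (suc k)

infixl 7 _⋆_
infixl 6 _⊕_

_⋆_ : Seq → Seq → Seq
(a ⋆ b) zero    = a 0 * b 0
(a ⋆ b) (suc n) = (∂ a ⋆ b) n + (a ⋆ ∂ b) n

_⊕_ : Seq → Seq → Seq
(a ⊕ b) k = a k + b k

neg : Seq → Seq
neg a k = - a k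

𝟘 𝟙 : Seq
𝟘 k = + 0
𝟙 zero    = + 1
𝟙 (suc k) = + 0

⋆-cong : ∀ {a a' b b'} → a ≗ a' → b ≗ b' → a ⋆ b ≗ a' ⋆ b'
⋆-cong p q zero    = cong₂ _*_ (p 0) (q 0)
⋆-cong p q (suc n) = cong₂ _+_ (⋆-cong (p ∘ suc) q n) (⋆-cong p (q ∘ suc) n)

⋆-congˡ : ∀ a {b b'} → b ≗ b' → a ⋆ b ≗ a ⋆ b'
⋆-congˡ a = ⋆-cong {a} (λ _ → refl)

⋆-congʳ : ∀ b {a a'} → a ≗ a' → a ⋆ b ≗ a' ⋆ b
⋆-congʳ b p = ⋆-cong p (λ _ → refl)

⋆-comm : ∀ a b → a ⋆ b ≗ b ⋆ a
⋆-comm a b zero    = *-comm (a 0) (b 0)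
⋆-comm a b (suc n) =
  trans (cong₂ _+_ (⋆-comm (∂ a) b n) (⋆-comm a (∂ b) n)) (+-comm ((b ⋆ ∂ a) n) _)

⋆-distribʳ : ∀ c a b → (a ⊕ b) ⋆ c ≗ a ⋆ c ⊕ b ⋆ c
⋆-distribʳ c a b zero    = *-distribʳ-+ (c 0) (a 0) (b 0)
⋆-distribʳ c a b (suc n) =
  trans (cong₂ _+_ (⋆-distribʳ c (∂ a) (∂ b) n) (⋆-distribʳ (∂ c) a b n))
        (interchange ((∂ a ⋆ c) n) ((∂ b ⋆ c) n) ((a ⋆ ∂ c) n) ((b ⋆ ∂ c) n))
  where
  interchange : ∀ x y z w → (x + y) + (z + w) ≡ (x + z) + (y + w)
  interchange = solve-∀

⋆-distribˡ : ∀ c a b → c ⋆ (a ⊕ b) ≗ c ⋆ a ⊕ c ⋆ b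
⋆-distribˡ c a b n =
  trans (⋆-comm c (a ⊕ b) n)
        (trans (⋆-distribʳ c a b n) (cong₂ _+_ (⋆-comm a c n) (⋆-comm b c n)))

⋆-negʳ : ∀ a b → a ⋆ neg b ≗ neg (a ⋆ b)
⋆-negʳ a b zero    = sym (neg-distribʳ-* (a 0) (b 0))
⋆-negʳ a b (suc n) =
  trans (cong₂ _+_ (⋆-negʳ (∂ a) b n) (⋆-negʳ a (∂ b) n))
        (sym (neg-distrib-+ ((∂ a ⋆ b) n) _))

⋆-assoc : ∀ a b c → (a ⋆ b) ⋆ c ≗ a ⋆ (b ⋆ c)
⋆-assoc a b c zero    = *-assoc (a 0) (b 0) (c 0)
⋆-assoc a b c (suc n) = begin
  (∂ (a ⋆ b) ⋆ c) n + ((a ⋆ b) ⋆ ∂ c) n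
    ≡⟨ cong₂ _+_ (⋆-distribʳ c (∂ a ⋆ b) (a ⋆ ∂ b) n) (⋆-assoc a b (∂ c) n) ⟩
  (((∂ a ⋆ b) ⋆ c) n + ((a ⋆ ∂ b) ⋆ c) n) + (a ⋆ (b ⋆ ∂ c)) n
    ≡⟨ cong (_+ (a ⋆ (b ⋆ ∂ c)) n) (cong₂ _+_ (⋆-assoc (∂ a) b c n) (⋆-assoc a (∂ b) c n)) ⟩
  ((∂ a ⋆ (b ⋆ c)) n + (a ⋆ (∂ b ⋆ c)) n) + (a ⋆ (b ⋆ ∂ c)) n
    ≡⟨ +-assoc ((∂ a ⋆ (b ⋆ c)) n) _ _ ⟩
  (∂ a ⋆ (b ⋆ c)) n + ((a ⋆ (∂ b ⋆ c)) n + (a ⋆ (b ⋆ ∂ c)) n)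
    ≡⟨ cong (_+_ ((∂ a ⋆ (b ⋆ c)) n)) (⋆-distribˡ a (∂ b ⋆ c) (b ⋆ ∂ c) n) ⟨
  (∂ a ⋆ (b ⋆ c)) n + (a ⋆ ∂ (b ⋆ c)) n
    ∎
  where open ≡-Reasoning

⋆-zeroˡ : ∀ b → 𝟘 ⋆ b ≗ 𝟘
⋆-zeroˡ b zero    = refl
⋆-zeroˡ b (suc n) = cong₂ _+_ (⋆-zeroˡ b n) (⋆-zeroˡ (∂ b) n)

⋆-identityˡ : ∀ a → 𝟙 ⋆ a ≗ a
⋆-identityˡ a zero    = *-identityˡ (a 0)
⋆-identityˡ a (suc n) =
  trans (cong₂ _+_ (⋆-zeroˡ a n) (⋆-identityˡ (∂ a) n)) (+-identityˡ _)

⋆-identityʳ : ∀ a → a ⋆ 𝟙 ≗ a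
⋆-identityʳ a n = trans (⋆-comm a 𝟙 n) (⋆-identityˡ a n)

cosh sinh : Seq
cosh zero    = + 1
cosh (suc k) = sinh k
sinh zero    = + 0
sinh (suc k) = cosh k

cosh²≗1+sinh² : cosh ⋆ cosh ≗ 𝟙 ⊕ sinh ⋆ sinh
cosh²≗1+sinh² zero    = refl
cosh²≗1+sinh² (suc n) =
  trans (+-comm ((sinh ⋆ cosh) n) _) (sym (+-identityˡ _))

double : ℕ → ℕ
double zero    = zero
double (suc n) = suc (suc (double n))

sinh-double : ∀ q → sinh (double q) ≡ + 0
sinh-double zero    = refl
sinh-double (suc q) = sinh-double q

cosh-double : ∀ q → cosh (double q) ≡ + 1
cosh-double zero    = refl
cosh-double (suc q) = cosh-double q

VanishesBelow : Seq → ℕ → Set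
VanishesBelow a K = ∀ j → j < K → a j ≡ + 0

∂-vanishesBelow : ∀ {a} K → VanishesBelow a K → VanishesBelow (∂ a) (pred K)
∂-vanishesBelow (suc K) h j j<K = h (suc j) (s≤s j<K)

1+m<I+J⇒m<pred[I]+J : ∀ {m} I J → suc m < I ℕ.+ J → m < pred I ℕ.+ J
1+m<I+J⇒m<pred[I]+J zero    J lt = ℕₚ.<⇒≤ lt
1+m<I+J⇒m<pred[I]+J (suc I) J lt = ℕₚ.≤-pred lt

⋆-vanishesBelow : ∀ {a b} I J → VanishesBelow a I → VanishesBelow b J →
                  VanishesBelow (a ⋆ b) (I ℕ.+ J)
⋆-vanishesBelow {a} zero    J ha hb zero lt = trans (cong (a 0 *_) (hb 0 lt)) (*-zeroʳ (a 0))
⋆-vanishesBelow {b = b} (suc I) J ha hb zero _ = trans (cong (_* b 0) (ha 0 z<s)) (*-zeroˡ (b 0))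
⋆-vanishesBelow I J ha hb (suc m) lt = cong₂ _+_
  (⋆-vanishesBelow (pred I) J (∂-vanishesBelow I ha) hb m (1+m<I+J⇒m<pred[I]+J I J lt))
  (⋆-vanishesBelow I (pred J) ha (∂-vanishesBelow J hb) m m<I+pred[J])
  where
  m<I+pred[J] : m < I ℕ.+ pred J
  m<I+pred[J] = subst (m <_) (ℕₚ.+-comm (pred J) I)
    (1+m<I+J⇒m<pred[I]+J J I (subst (suc m <_) (ℕₚ.+-comm I J) lt))

Σ< : ℕ → (ℕ → ℤ) → ℤ
Σ< n f = Σℤ (applyUpTo f n)

Σ<-cong : ∀ n {f g} → (∀ k → k < n → f k ≡ g k) → Σ< n f ≡ Σ< n g
Σ<-cong zero    h = refl
Σ<-cong (suc n) h = cong₂ _+_ (h 0 z<s) (Σ<-cong n (λ k k<n → h (suc k) (s≤s k<n)))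

Σ<-suc : ∀ n f → Σ< (suc n) f ≡ Σ< n f + f n
Σ<-suc zero    f = trans (+-identityʳ (f 0)) (sym (+-identityˡ (f 0)))
Σ<-suc (suc n) f =
  trans (cong (_+_ (f 0)) (Σ<-suc n (f ∘ suc))) (sym (+-assoc (f 0) _ _))

Σ<-distrib-+ : ∀ n f g → Σ< n (λ k → f k + g k) ≡ Σ< n f + Σ< n g
Σ<-distrib-+ zero    f g = refl
Σ<-distrib-+ (suc n) f g =
  trans (cong (_+_ (f 0 + g 0)) (Σ<-distrib-+ n (f ∘ suc) (g ∘ suc)))
        (interchange (f 0) (g 0) (Σ< n (f ∘ suc)) (Σ< n (g ∘ suc)))
  where
  interchange : ∀ x y z w → (x + y) + (z + w) ≡ (x + z) + (y + w)
  interchange = solve-∀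

Σ<-extend : ∀ {n M} f → n ≤ M → (∀ k → n ≤ k → f k ≡ + 0) → Σ< n f ≡ Σ< M f
Σ<-extend {zero}  {zero}  f _ _ = refl
Σ<-extend {zero}  {suc M} f _ h =
  sym (cong₂ _+_ (h 0 z≤n) (sym (Σ<-extend {M = M} (f ∘ suc) z≤n (λ k _ → h (suc k) z≤n))))
Σ<-extend {suc n} {suc M} f n≤M h =
  cong (_+_ (f 0)) (Σ<-extend (f ∘ suc) (ℕₚ.≤-pred n≤M) (λ k n≤k → h (suc k) (s≤s n≤k)))

Σ<-double : ∀ B f → (∀ q → f (double q) ≡ + 0) → Σ< (double B) f ≡ Σ< B (f ∘ suc ∘ double)
Σ<-double zero    f h = refl
Σ<-double (suc B) f h = begin
  f 0 + (f 1 + Σ< (double B) (f ∘ suc ∘ suc))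
    ≡⟨ cong (_+ (f 1 + Σ< (double B) (f ∘ suc ∘ suc))) (h 0) ⟩
  + 0 + (f 1 + Σ< (double B) (f ∘ suc ∘ suc))
    ≡⟨ +-identityˡ _ ⟩
  f 1 + Σ< (double B) (f ∘ suc ∘ suc)
    ≡⟨ cong (_+_ (f 1)) (Σ<-double B (f ∘ suc ∘ suc) (h ∘ suc)) ⟩
  f 1 + Σ< B (f ∘ suc ∘ double ∘ suc)
    ∎
  where open ≡-Reasoning

n<m⇒m∸n≡1+[m∸1+n] : ∀ {m n} → n < m → m ∸ n ≡ suc (m ∸ suc n)
n<m⇒m∸n≡1+[m∸1+n] {suc m} {zero}  _          = refl
n<m⇒m∸n≡1+[m∸1+n] {suc m} {suc n} (s≤s n<m) = n<m⇒m∸n≡1+[m∸1+n] n<m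

⋆-binomial : ∀ a b n → (a ⋆ b) n ≡ Σ< (suc n) (λ k → + (n C k) * a k * b (n ∸ k))
⋆-binomial a b zero    = leftOver (a 0) (b 0)
  where
  leftOver : ∀ x y → x * y ≡ + 1 * x * y + + 0
  leftOver = solve-∀
⋆-binomial a b (suc n) = begin
  (∂ a ⋆ b) n + (a ⋆ ∂ b) n
    ≡⟨ cong₂ _+_ (⋆-binomial (∂ a) b n) (⋆-binomial a (∂ b) n) ⟩
  Σ< (suc n) f + (t₀ + Σ< n g)
    ≡⟨ cong (λ x → Σ< (suc n) f + (t₀ + x)) reindex ⟨
  Σ< (suc n) f + (t₀ + Σ< (suc n) g′)
    ≡⟨ swap (Σ< (suc n) f) t₀ _ ⟩
  t₀ + (Σ< (suc n) f + Σ< (suc n) g′)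
    ≡⟨ cong (_+_ t₀) (Σ<-distrib-+ (suc n) f g′) ⟨
  t₀ + Σ< (suc n) (λ k → f k + g′ k)
    ≡⟨ cong (_+_ t₀) (Σ<-cong (suc n) (λ k _ → pascal k)) ⟩
  t₀ + Σ< (suc n) (λ k → + (suc n C suc k) * a (suc k) * b (n ∸ k))
    ∎
  where
  open ≡-Reasoning
  t₀ = + 1 * a 0 * b (suc n)
  f g g′ : ℕ → ℤ
  f k  = + (n C k) * a (suc k) * b (n ∸ k)
  g k  = + (n C suc k) * a (suc k) * b (suc (n ∸ suc k))
  g′ k = + (n C suc k) * a (suc k) * b (n ∸ k)
  swap : ∀ x y z → x + (y + z) ≡ y + (x + z)
  swap = solve-∀
  reindex : Σ< (suc n) g′ ≡ Σ< n g
  reindex = begin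
    Σ< (suc n) g′           ≡⟨ Σ<-suc n g′ ⟩
    Σ< n g′ + g′ n          ≡⟨ cong₂ _+_ (Σ<-cong n g′≡g) g′n≡0 ⟩
    Σ< n g + + 0            ≡⟨ +-identityʳ _ ⟩
    Σ< n g                  ∎
    where
    g′≡g : ∀ k → k < n → g′ k ≡ g k
    g′≡g k k<n = cong (λ i → + (n C suc k) * a (suc k) * b i) (n<m⇒m∸n≡1+[m∸1+n] k<n)
    g′n≡0 : g′ n ≡ + 0
    g′n≡0 = cong (λ c → + c * a (suc n) * b (n ∸ n)) (k>n⇒nCk≡0 (ℕₚ.n<1+n n))
  pascal : ∀ k → f k + g′ k ≡ + (suc n C suc k) * a (suc k) * b (n ∸ k)
  pascal k = begin
    + (n C k) * a (suc k) * b (n ∸ k) + + (n C suc k) * a (suc k) * b (n ∸ k)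
      ≡⟨ factor (+ (n C k)) (+ (n C suc k)) (a (suc k)) (b (n ∸ k)) ⟩
    (+ (n C k) + + (n C suc k)) * a (suc k) * b (n ∸ k)
      ≡⟨ cong (λ c → c * a (suc k) * b (n ∸ k)) (pos-+ (n C k) (n C suc k)) ⟨
    + (n C k ℕ.+ n C suc k) * a (suc k) * b (n ∸ k)
      ≡⟨ cong (λ c → + c * a (suc k) * b (n ∸ k)) (nCk+nC[k+1]≡[n+1]C[k+1] n k) ⟩
    + (suc n C suc k) * a (suc k) * b (n ∸ k)
      ∎
    where
    factor : ∀ c d x y → c * x * y + d * x * y ≡ (c + d) * x * y
    factor = solve-∀

ifEven≡*cosh : ∀ j x → (if j ℕ.% 2 ≡ᵇ 0 then x else + 0) ≡ x * cosh j
ifEven≡*cosh zero          x = sym (*-identityʳ x)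
ifEven≡*cosh (suc zero)    x = sym (*-zeroʳ x)
ifEven≡*cosh (suc (suc j)) x = ifEven≡*cosh j x

Eaux-fuel : ∀ f f′ k → k < f → k < f′ → Eaux f k ≡ Eaux f′ k
Eaux-fuel (suc f) (suc f′) zero    _    _     = refl
Eaux-fuel (suc f) (suc f′) (suc m) m<f m<f′ = cong -_ (Σ<-cong (suc m) (λ k k<m →
  cong (λ x → if (suc m ∸ k) ℕ.% 2 ≡ᵇ 0 then + (suc m C k) * x else + 0)
       (Eaux-fuel f f′ k (ℕₚ.<-≤-trans k<m (ℕₚ.≤-pred m<f))
                         (ℕₚ.<-≤-trans k<m (ℕₚ.≤-pred m<f′)))))

E⋆cosh≗𝟙 : E ⋆ cosh ≗ 𝟙
E⋆cosh≗𝟙 zero    = refl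
E⋆cosh≗𝟙 (suc m) = begin
  (E ⋆ cosh) (suc m)                 ≡⟨ ⋆-binomial E cosh (suc m) ⟩
  Σ< (suc (suc m)) term              ≡⟨ Σ<-suc (suc m) term ⟩
  Σ< (suc m) term + term (suc m)     ≡⟨ cong₂ _+_ (Σ<-cong (suc m) recurrence) lastTerm ⟩
  Σ< (suc m) eTerm + E (suc m)       ≡⟨ +-inverseʳ (Σ< (suc m) eTerm) ⟩
  + 0                                ∎
  where
  open ≡-Reasoning
  term eTerm : ℕ → ℤ
  term k  = + (suc m C k) * E k * cosh (suc m ∸ k)
  eTerm k = if (suc m ∸ k) ℕ.% 2 ≡ᵇ 0 then + (suc m C k) * Eaux (suc m) k else + 0
  recurrence : ∀ k → k < suc m → term k ≡ eTerm k
  recurrence k k<1+m = sym (trans (ifEven≡*cosh (suc m ∸ k) _)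
    (cong (λ x → + (suc m C k) * x * cosh (suc m ∸ k))
          (Eaux-fuel (suc m) (suc k) k k<1+m (ℕₚ.n<1+n k))))
  lastTerm : term (suc m) ≡ E (suc m)
  lastTerm = begin
    + (suc m C suc m) * E (suc m) * cosh (m ∸ m)
      ≡⟨ cong₂ (λ c j → + c * E (suc m) * cosh j) (nCn≡1 (suc m)) (ℕₚ.n∸n≡0 m) ⟩
    + 1 * E (suc m) * + 1
      ≡⟨ unit (E (suc m)) ⟩
    E (suc m)
      ∎
    where
    unit : ∀ x → + 1 * x * + 1 ≡ x
    unit = solve-∀

sinh^ : ℕ → Seq
sinh^ zero    = 𝟙
sinh^ (suc K) = sinh ⋆ sinh^ K

sinh^-vanishesBelow : ∀ K → VanishesBelow (sinh^ K) K
sinh^-vanishesBelow zero    j ()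
sinh^-vanishesBelow (suc K) =
  ⋆-vanishesBelow 1 K (λ { zero _ → refl ; (suc _) (s≤s ()) }) (sinh^-vanishesBelow K)

alternatingOddPowers : ℕ → Seq
alternatingOddPowers L m = Σ< L (λ N → (-1ℤ ^ suc N) * sinh^ (suc (double N)) m)

module ReciprocalOfCosh (e : Seq) (e⋆cosh≗𝟙 : e ⋆ cosh ≗ 𝟙) where

  e² cosh² : Seq
  e²    = e ⋆ e
  cosh² = cosh ⋆ cosh

  e²⋆cosh²≗𝟙 : e² ⋆ cosh² ≗ 𝟙
  e²⋆cosh²≗𝟙 n = begin
    (e² ⋆ cosh²) n           ≡⟨ ⋆-assoc e e cosh² n ⟩
    (e ⋆ (e ⋆ cosh²)) n      ≡⟨ ⋆-congˡ e (λ k → ⋆-assoc e cosh cosh k) n ⟨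
    (e ⋆ ((e ⋆ cosh) ⋆ cosh)) n ≡⟨ ⋆-congˡ e (⋆-congʳ cosh e⋆cosh≗𝟙) n ⟩
    (e ⋆ (𝟙 ⋆ cosh)) n       ≡⟨ ⋆-congˡ e (⋆-identityˡ cosh) n ⟩
    (e ⋆ cosh) n             ≡⟨ e⋆cosh≗𝟙 n ⟩
    𝟙 n                      ∎
    where open ≡-Reasoning

  e²⋆cosh²-cancel : ∀ X → e² ⋆ (cosh² ⋆ X) ≗ X
  e²⋆cosh²-cancel X n = trans (sym (⋆-assoc e² cosh² X n))
    (trans (⋆-congʳ X e²⋆cosh²≗𝟙 n) (⋆-identityˡ X n))

  -- the coefficient of degree suc n in e ⋆ cosh ≗ 𝟙, since ∂ cosh = sinh
  ∂e⋆cosh≗-e⋆sinh : ∂ e ⋆ cosh ≗ neg (e ⋆ sinh)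
  ∂e⋆cosh≗-e⋆sinh n = inverseˡ-unique ((∂ e ⋆ cosh) n) ((e ⋆ sinh) n) (e⋆cosh≗𝟙 (suc n))

  cosh²⋆∂e≗-sinh : cosh² ⋆ ∂ e ≗ neg sinh
  cosh²⋆∂e≗-sinh n = begin
    (cosh² ⋆ ∂ e) n              ≡⟨ ⋆-assoc cosh cosh (∂ e) n ⟩
    (cosh ⋆ (cosh ⋆ ∂ e)) n      ≡⟨ ⋆-congˡ cosh cosh⋆∂e n ⟩
    (cosh ⋆ neg (e ⋆ sinh)) n    ≡⟨ ⋆-negʳ cosh (e ⋆ sinh) n ⟩
    - (cosh ⋆ (e ⋆ sinh)) n      ≡⟨ cong -_ (⋆-assoc cosh e sinh n) ⟨
    - ((cosh ⋆ e) ⋆ sinh) n      ≡⟨ cong -_ (⋆-congʳ sinh cosh⋆e n) ⟩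
    - (𝟙 ⋆ sinh) n               ≡⟨ cong -_ (⋆-identityˡ sinh n) ⟩
    - sinh n                     ∎
    where
    open ≡-Reasoning
    cosh⋆∂e : cosh ⋆ ∂ e ≗ neg (e ⋆ sinh)
    cosh⋆∂e k = trans (⋆-comm cosh (∂ e) k) (∂e⋆cosh≗-e⋆sinh k)
    cosh⋆e : cosh ⋆ e ≗ 𝟙
    cosh⋆e k = trans (⋆-comm cosh e k) (e⋆cosh≗𝟙 k)

  ∂e≗-e²⋆sinh : ∂ e ≗ neg (e² ⋆ sinh)
  ∂e≗-e²⋆sinh n = trans (sym (e²⋆cosh²-cancel (∂ e) n))
    (trans (⋆-congˡ e² cosh²⋆∂e≗-sinh n) (⋆-negʳ e² sinh n))

  e²⋆p+e²⋆sinh²⋆p≗p : ∀ p → e² ⋆ p ⊕ e² ⋆ (sinh ⋆ (sinh ⋆ p)) ≗ p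
  e²⋆p+e²⋆sinh²⋆p≗p p n = trans (sym (⋆-distribˡ e² p (sinh ⋆ (sinh ⋆ p)) n))
    (trans (⋆-congˡ e² cosh²⋆p n) (e²⋆cosh²-cancel p n))
    where
    cosh²⋆p : p ⊕ sinh ⋆ (sinh ⋆ p) ≗ cosh² ⋆ p
    cosh²⋆p k = sym (begin
      (cosh² ⋆ p) k                       ≡⟨ ⋆-congʳ p cosh²≗1+sinh² k ⟩
      ((𝟙 ⊕ sinh ⋆ sinh) ⋆ p) k           ≡⟨ ⋆-distribʳ p 𝟙 (sinh ⋆ sinh) k ⟩
      (𝟙 ⋆ p) k + ((sinh ⋆ sinh) ⋆ p) k   ≡⟨ cong₂ _+_ (⋆-identityˡ p k) (⋆-assoc sinh sinh p k) ⟩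
      p k + (sinh ⋆ (sinh ⋆ p)) k         ∎)
      where open ≡-Reasoning

  alternatingOddPowers-telescope : ∀ L m →
    alternatingOddPowers L m ≡ - (e² ⋆ sinh) m + (-1ℤ ^ L) * (e² ⋆ sinh^ (suc (double L))) m
  alternatingOddPowers-telescope zero m = sym (begin
    - (e² ⋆ sinh) m + + 1 * (e² ⋆ (sinh ⋆ 𝟙)) m
      ≡⟨ cong (λ x → - (e² ⋆ sinh) m + + 1 * x) (⋆-congˡ e² (⋆-identityʳ sinh) m) ⟩
    - (e² ⋆ sinh) m + + 1 * (e² ⋆ sinh) m
      ≡⟨ cancel ((e² ⋆ sinh) m) ⟩
    + 0
      ∎)
    where
    open ≡-Reasoning
    cancel : ∀ x → - x + + 1 * x ≡ + 0
    cancel = solve-∀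
  alternatingOddPowers-telescope (suc L) m = begin
    alternatingOddPowers (suc L) m
      ≡⟨ Σ<-suc L (λ N → (-1ℤ ^ suc N) * sinh^ (suc (double N)) m) ⟩
    alternatingOddPowers L m + -1ℤ * s * p m
      ≡⟨ cong (_+ -1ℤ * s * p m) (alternatingOddPowers-telescope L m) ⟩
    (- r + s * x) + -1ℤ * s * p m
      ≡⟨ cong (λ z → (- r + s * x) + -1ℤ * s * z) (e²⋆p+e²⋆sinh²⋆p≗p p m) ⟨
    (- r + s * x) + -1ℤ * s * (x + y)
      ≡⟨ collect r s x y ⟩
    - r + -1ℤ * s * y
      ∎
    where
    open ≡-Reasoning
    p : Seq
    p = sinh^ (suc (double L))
    r s x y : ℤ
    r = (e² ⋆ sinh) m
    s = -1ℤ ^ L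
    x = (e² ⋆ p) m
    y = (e² ⋆ (sinh ⋆ (sinh ⋆ p))) m
    collect : ∀ r s x y → (- r + s * x) + -1ℤ * s * (x + y) ≡ - r + -1ℤ * s * y
    collect = solve-∀

  ∂e≡alternatingOddPowers : ∀ L m → m < suc (double L) → ∂ e m ≡ alternatingOddPowers L m
  ∂e≡alternatingOddPowers L m m<2L+1 = begin
    ∂ e m                                  ≡⟨ ∂e≗-e²⋆sinh m ⟩
    - (e² ⋆ sinh) m                        ≡⟨ +-identityʳ _ ⟨
    - (e² ⋆ sinh) m + + 0                  ≡⟨ cong (_+_ (- (e² ⋆ sinh) m)) (*-zeroʳ (-1ℤ ^ L)) ⟨
    - (e² ⋆ sinh) m + (-1ℤ ^ L) * + 0      ≡⟨ cong (λ x → - (e² ⋆ sinh) m + (-1ℤ ^ L) * x) remainder≡0 ⟨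
    - (e² ⋆ sinh) m + (-1ℤ ^ L) * (e² ⋆ sinh^ (suc (double L))) m
                                           ≡⟨ alternatingOddPowers-telescope L m ⟨
    alternatingOddPowers L m               ∎
    where
    open ≡-Reasoning
    remainder≡0 : (e² ⋆ sinh^ (suc (double L))) m ≡ + 0
    remainder≡0 = ⋆-vanishesBelow 0 (suc (double L)) (λ _ ()) (sinh^-vanishesBelow _) m m<2L+1

multinomial-≡ : ∀ n rs → sum rs ≡ n → multinomial n rs ≡ (n ! / prodFact rs) {{prodFact≢0 rs}}
multinomial-≡ n rs eq with sum rs ≟ n
... | yes _ = refl
... | no ≢n = ⊥-elim (≢n eq)

multinomial-≢ : ∀ n rs → sum rs ≢ n → multinomial n rs ≡ 0
multinomial-≢ n rs ≢n with sum rs ≟ n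
... | yes eq = ⊥-elim (≢n eq)
... | no _   = refl

prodFact∣sum! : ∀ rs → prodFact rs ∣ sum rs !
prodFact∣sum! []       = ∣-refl
prodFact∣sum! (r ∷ rs) = ∣-trans (*-monoʳ-∣ (r !) (prodFact∣sum! rs))
  (subst (λ k → r ! ℕ.* k ! ∣ (r ℕ.+ sum rs) !) (ℕₚ.m+n∸m≡n r (sum rs))
         (k![n∸k]!∣n! (ℕₚ.m≤m+n r (sum rs))))

multinomial-∷ : ∀ m r rs → multinomial m (r ∷ rs) ≡ (m C r) ℕ.* multinomial (m ∸ r) rs
multinomial-∷ m r rs with r ℕ.≤? m
... | no r≰m  = trans
  (multinomial-≢ m (r ∷ rs) (λ eq → r≰m (subst (r ≤_) eq (ℕₚ.m≤m+n r (sum rs)))))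
  (sym (cong (ℕ._* multinomial (m ∸ r) rs) (k>n⇒nCk≡0 (ℕₚ.≰⇒> r≰m))))
... | yes r≤m = byTailSum (sum rs ≟ m ∸ r)
  where
  byTailSum : Dec (sum rs ≡ m ∸ r) → multinomial m (r ∷ rs) ≡ (m C r) ℕ.* multinomial (m ∸ r) rs
  byTailSum (no ≢m∸r) = trans
    (multinomial-≢ m (r ∷ rs) (λ eq → ≢m∸r (trans (sym (ℕₚ.m+n∸m≡n r (sum rs))) (cong (_∸ r) eq))))
    (sym (trans (cong ((m C r) ℕ.*_) (multinomial-≢ (m ∸ r) rs ≢m∸r)) (ℕₚ.*-zeroʳ (m C r))))
  byTailSum (yes ≡m∸r) = begin
    multinomial m (r ∷ rs)                  ≡⟨ multinomial-≡ m (r ∷ rs) sum≡m ⟩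
    m ! / (r ! ℕ.* P)                       ≡⟨ cong (_/ (r ! ℕ.* P)) m!≡ ⟩
    (c ℕ.* Q) ℕ.* (r ! ℕ.* P) / (r ! ℕ.* P) ≡⟨ m*n/n≡m (c ℕ.* Q) (r ! ℕ.* P) ⟩
    c ℕ.* Q                                 ≡⟨ cong (c ℕ.*_) (multinomial-≡ (m ∸ r) rs ≡m∸r) ⟨
    c ℕ.* multinomial (m ∸ r) rs            ∎
    where
    open ≡-Reasoning
    sum≡m : r ℕ.+ sum rs ≡ m
    sum≡m = trans (cong (r ℕ.+_) ≡m∸r) (ℕₚ.m+[n∸m]≡n r≤m)
    P c Q F : ℕ
    P = prodFact rs
    c = m C r
    Q = ((m ∸ r) ! / P) {{prodFact≢0 rs}}
    F = r ! ℕ.* (m ∸ r) !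
    instance
      P≢0 : NonZero P
      P≢0 = prodFact≢0 rs
      r!P≢0 : NonZero (r ! ℕ.* P)
      r!P≢0 = prodFact≢0 (r ∷ rs)
      F≢0 : NonZero F
      F≢0 = ℕₚ.m*n≢0 (r !) ((m ∸ r) !) {{r ℕₚ.!≢0}} {{(m ∸ r) ℕₚ.!≢0}}
    m!≡ : m ! ≡ (c ℕ.* Q) ℕ.* (r ! ℕ.* P)
    m!≡ = begin
      m !                        ≡⟨ m/n*n≡m (k![n∸k]!∣n! r≤m) ⟨
      m ! / F ℕ.* F              ≡⟨ cong (ℕ._* F) (nCk≡n!/k![n-k]! r≤m) ⟨
      c ℕ.* (r ! ℕ.* (m ∸ r) !)  ≡⟨ cong (λ x → c ℕ.* (r ! ℕ.* x)) (m/n*n≡m P∣[m∸r]!) ⟨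
      c ℕ.* (r ! ℕ.* (Q ℕ.* P))  ≡⟨ regroup c (r !) Q P ⟩
      (c ℕ.* Q) ℕ.* (r ! ℕ.* P)  ∎
      where
      P∣[m∸r]! : P ∣ (m ∸ r) !
      P∣[m∸r]! = subst (λ k → P ∣ k !) ≡m∸r (prodFact∣sum! rs)
      regroup : ∀ a b x y → a ℕ.* (b ℕ.* (x ℕ.* y)) ≡ (a ℕ.* x) ℕ.* (b ℕ.* y)
      regroup = ℕ-Solver.solve-∀

sum-map-concatMap : ∀ {A B : Set} (f : B → ℕ) (g : A → List B) xs →
                    sum (map f (concatMap g xs)) ≡ sum (map (sum ∘ map f ∘ g) xs)
sum-map-concatMap f g []       = refl
sum-map-concatMap f g (x ∷ xs) = begin
  sum (map f (g x List.++ concatMap g xs))             ≡⟨ cong sum (map-++ f (g x) (concatMap g xs)) ⟩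
  sum (map f (g x) List.++ map f (concatMap g xs))     ≡⟨ sum-++ (map f (g x)) _ ⟩
  sum (map f (g x)) ℕ.+ sum (map f (concatMap g xs))   ≡⟨ cong (sum (map f (g x)) ℕ.+_) (sum-map-concatMap f g xs) ⟩
  sum (map f (g x)) ℕ.+ sum (map (sum ∘ map f ∘ g) xs) ∎
  where open ≡-Reasoning

sum-map-*ˡ : ∀ {A : Set} c (g : A → ℕ) xs → sum (map (λ x → c ℕ.* g x) xs) ≡ c ℕ.* sum (map g xs)
sum-map-*ˡ c g []       = sym (ℕₚ.*-zeroʳ c)
sum-map-*ˡ c g (x ∷ xs) =
  trans (cong (c ℕ.* g x ℕ.+_) (sum-map-*ˡ c g xs)) (sym (ℕₚ.*-distribˡ-+ c (g x) _))

pos-sum-map : ∀ {A : Set} (h : A → ℕ) xs → + sum (map h xs) ≡ Σℤ (map (+_ ∘ h) xs)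
pos-sum-map h []       = refl
pos-sum-map h (x ∷ xs) = trans (pos-+ (h x) _) (cong (_+_ (+ h x)) (pos-sum-map h xs))

double≡2* : ∀ n → double n ≡ 2 ℕ.* n
double≡2* zero    = refl
double≡2* (suc n) = cong suc (trans (cong suc (double≡2* n)) (sym (ℕₚ.+-suc n (n ℕ.+ 0))))

n≤1+double[n/2] : ∀ n → n ≤ suc (double (n / 2))
n≤1+double[n/2] n = begin
  n                         ≡⟨ m≡m%n+[m/n]*n n 2 ⟩
  n ℕ.% 2 ℕ.+ n / 2 ℕ.* 2   ≤⟨ ℕₚ.+-monoˡ-≤ (n / 2 ℕ.* 2) (ℕₚ.≤-pred (m%n<n n 2)) ⟩
  suc (n / 2 ℕ.* 2)         ≡⟨ cong suc (trans (ℕₚ.*-comm (n / 2) 2) (sym (double≡2* (n / 2)))) ⟩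
  suc (double (n / 2))      ∎
  where open ℕₚ.≤-Reasoning

oddPart : ℕ → ℕ
oddPart q = 2 ℕ.* q ∸ 1

oddPart-suc : ∀ q → oddPart (suc q) ≡ suc (double q)
oddPart-suc q = trans (ℕₚ.+-suc q (q ℕ.+ 0)) (cong suc (sym (double≡2* q)))

oddCompositionSum : ℕ → ℕ → ℕ → ℕ
oddCompositionSum B K m = sum (map (λ qs → multinomial m (map oddPart qs)) (tuples K (oneTo B)))

oddCompositionSum-suc : ∀ B K m → oddCompositionSum B (suc K) m ≡
  sum (map (λ q → (m C oddPart q) ℕ.* oddCompositionSum B K (m ∸ oddPart q)) (oneTo B))
oddCompositionSum-suc B K m =
  trans (sum-map-concatMap (λ qs → multinomial m (map oddPart qs)) (λ q → map (q ∷_) tuplesK) (oneTo B))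
        (cong sum (map-cong byFirstEntry (oneTo B)))
  where
  tuplesK : List (List ℕ)
  tuplesK = tuples K (oneTo B)
  byFirstEntry : ∀ q → sum (map (λ qs → multinomial m (map oddPart qs)) (map (q ∷_) tuplesK)) ≡
                    (m C oddPart q) ℕ.* oddCompositionSum B K (m ∸ oddPart q)
  byFirstEntry q = begin
    sum (map (λ qs → multinomial m (map oddPart qs)) (map (q ∷_) tuplesK))
      ≡⟨ cong sum (map-∘ tuplesK) ⟨
    sum (map (λ t → multinomial m (oddPart q ∷ map oddPart t)) tuplesK)
      ≡⟨ cong sum (map-cong (λ t → multinomial-∷ m (oddPart q) (map oddPart t)) tuplesK) ⟩
    sum (map (λ t → (m C oddPart q) ℕ.* multinomial (m ∸ oddPart q) (map oddPart t)) tuplesK)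
      ≡⟨ sum-map-*ˡ (m C oddPart q) (λ t → multinomial (m ∸ oddPart q) (map oddPart t)) tuplesK ⟩
    (m C oddPart q) ℕ.* oddCompositionSum B K (m ∸ oddPart q)
      ∎
    where open ≡-Reasoning

sinh^-coefficient : ∀ B K m → m ≤ double B → + oddCompositionSum B K m ≡ sinh^ K m
sinh^-coefficient B zero    zero    _ = refl
sinh^-coefficient B zero    (suc m) _ = refl
sinh^-coefficient B (suc K) m m≤2B = begin
  + oddCompositionSum B (suc K) m
    ≡⟨ cong +_ (oddCompositionSum-suc B K m) ⟩
  + sum (map (λ q → (m C oddPart q) ℕ.* oddCompositionSum B K (m ∸ oddPart q)) (applyUpTo suc B))
    ≡⟨ pos-sum-map _ (applyUpTo suc B) ⟩
  Σℤ (map (λ q → + ((m C oddPart q) ℕ.* oddCompositionSum B K (m ∸ oddPart q))) (applyUpTo suc B))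
    ≡⟨ cong Σℤ (map-applyUpTo suc _ B) ⟩
  Σ< B (λ q → + ((m C oddPart (suc q)) ℕ.* oddCompositionSum B K (m ∸ oddPart (suc q))))
    ≡⟨ Σ<-cong B (λ q _ → oddTerm q) ⟩
  Σ< B (term ∘ suc ∘ double)
    ≡⟨ Σ<-double B term evenTerm ⟨
  Σ< (double B) term
    ≡⟨ trans (cong (_+_ (Σ< (double B) term)) (evenTerm B)) (+-identityʳ _) ⟨
  Σ< (double B) term + term (double B)
    ≡⟨ Σ<-suc (double B) term ⟨
  Σ< (suc (double B)) term
    ≡⟨ Σ<-extend term (s≤s m≤2B) beyondM ⟨
  Σ< (suc m) term
    ≡⟨ ⋆-binomial sinh (sinh^ K) m ⟨
  sinh^ (suc K) m
    ∎
  where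
  open ≡-Reasoning
  term : ℕ → ℤ
  term k = + (m C k) * sinh k * sinh^ K (m ∸ k)
  evenTerm : ∀ q → term (double q) ≡ + 0
  evenTerm q = trans (cong (λ x → + (m C double q) * x * sinh^ K (m ∸ double q)) (sinh-double q))
                     (zeroMiddle (+ (m C double q)) _)
    where
    zeroMiddle : ∀ c y → c * + 0 * y ≡ + 0
    zeroMiddle = solve-∀
  beyondM : ∀ k → suc m ≤ k → term k ≡ + 0
  beyondM k m<k = trans (cong (λ c → + c * sinh k * sinh^ K (m ∸ k)) (k>n⇒nCk≡0 m<k))
                        (trans (cong (_* sinh^ K (m ∸ k)) (*-zeroˡ (sinh k))) (*-zeroˡ (sinh^ K (m ∸ k))))
  oddTerm : ∀ q → + ((m C oddPart (suc q)) ℕ.* oddCompositionSum B K (m ∸ oddPart (suc q))) ≡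
                  term (suc (double q))
  oddTerm q = begin
    + ((m C oddPart (suc q)) ℕ.* oddCompositionSum B K (m ∸ oddPart (suc q)))
      ≡⟨ cong (λ r → + ((m C r) ℕ.* oddCompositionSum B K (m ∸ r))) (oddPart-suc q) ⟩
    + ((m C k) ℕ.* oddCompositionSum B K (m ∸ k))
      ≡⟨ pos-* (m C k) _ ⟩
    + (m C k) * + oddCompositionSum B K (m ∸ k)
      ≡⟨ cong (_*_ (+ (m C k))) (sinh^-coefficient B K (m ∸ k) (ℕₚ.≤-trans (ℕₚ.m∸n≤m m k) m≤2B)) ⟩
    + (m C k) * sinh^ K (m ∸ k)
      ≡⟨ cong (λ x → x * sinh^ K (m ∸ k)) (*-identityʳ (+ (m C k))) ⟨
    + (m C k) * + 1 * sinh^ K (m ∸ k)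
      ≡⟨ cong (λ x → + (m C k) * x * sinh^ K (m ∸ k)) (cosh-double q) ⟨
    term k
      ∎
    where
    k = suc (double q)

eulerRHS-suc : ∀ m → eulerRHS (suc m) ≡ alternatingOddPowers (suc m / 2) m
eulerRHS-suc m = trans (cong Σℤ (map-applyUpTo suc _ B)) (Σ<-cong B (λ N _ →
  cong ((-1ℤ ^ suc N) *_) (trans (cong (λ K → + oddCompositionSum B K m) (oddPart-suc N))
                                 (sinh^-coefficient B (suc (double N)) m m≤2B))))
  where
  B = suc m / 2
  m≤2B : m ≤ double B
  m≤2B = ℕₚ.≤-pred (n≤1+double[n/2] (suc m))

open ReciprocalOfCosh E E⋆cosh≗𝟙 using (∂e≡alternatingOddPowers)

proposition1 : ∀ (n : ℕ) → 1 < n → E n ≡ eulerRHS n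
proposition1 (suc m) _ = begin
  E (suc m)                 ≡⟨ ∂e≡alternatingOddPowers B m (n≤1+double[n/2] (suc m)) ⟩
  alternatingOddPowers B m  ≡⟨ eulerRHS-suc m ⟨
  eulerRHS (suc m)          ∎
  where
  open ≡-Reasoning
  B = suc m / 2
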